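{- Let $q$ be a power of $2$ and let $K$ be a complete arc in $PG(2,q)$. Then $K$ has at least one sum-point.
   Context: An arc in $PG(2,q)$ is a set of points no three collinear; complete if not contained in a larger arc. A point is in normalized form if its first nonzero homogeneous coordinate is $1$. For a complete arc $K$ and $Q\in PG(2,q)\setminus K$ in normalized form, for each secant $l$ of $K$ through $Q$ (line meeting $K$ in two points) write $Q=c_1^{(l)}P_1+c_2^{(l)}P_2$ with $c_i^{(l)}\in\mathbb{F}_q^*$, where $P_1,P_2$ are the points of $l\cap K$ in normalized form. $Q$ is a sum-point for $K$ if $c_1^{(l)}=c_2^{(l)}$ for every secant $l$ of $K$ through $Q$. -}

module Defs where

open import Level using (Level; _⊔_; suc)
open import Algebra.Bundles using (CommutativeRing)
open import Data.Nat as ℕ using (ℕ)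
open import Data.List using (List; length; _∷_)
open import Data.List.Relation.Unary.Any using (Any)
open import Data.List.Relation.Unary.AllPairs using (AllPairs)
open import Data.Product using (Σ; ∃; _×_; _,_; proj₁)
open import Data.Sum using (_⊎_)
open import Relation.Nullary using (¬_)
open import Relation.Binary.PropositionalEquality using (_≡_)

record Field (c ℓ : Level) : Set (Level.suc (c ⊔ ℓ)) where
  field
    commRing : CommutativeRing c ℓ
  open CommutativeRing commRing public
  field
    0≉1     : ¬ (0# ≈ 1#)
    inverse : ∀ x → ¬ (x ≈ 0#) → ∃ λ y → (x * y) ≈ 1#

HasOrder : ∀ {c ℓ} → Field c ℓ → ℕ → Set (c ⊔ ℓ)
HasOrder F q = Σ (List Carrier) λ xs →
    AllPairs (λ x y → ¬ (x ≈ y)) xs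
  × (∀ x → Any (x ≈_) xs)
  × length xs ≡ q
  where open Field F

module Plane {c ℓ} (F : Field c ℓ) where
  open Field F

  Vec3 : Set c
  Vec3 = Carrier × Carrier × Carrier

  Normalized : Vec3 → Set ℓ
  Normalized (x , y , z) =
      (x ≈ 1#)
    ⊎ ((x ≈ 0#) × (y ≈ 1#))
    ⊎ ((x ≈ 0#) × (y ≈ 0#) × (z ≈ 1#))

  -- points of PG(2,F), each represented by its normalized coordinate triple
  Point : Set (c ⊔ ℓ)
  Point = Σ Vec3 Normalized

  coords : Point → Vec3
  coords = proj₁

  _≈P_ : Point → Point → Set ℓ
  P ≈P Q with coords P | coords Q
  ... | (x , y , z) | (x' , y' , z') = (x ≈ x') × (y ≈ y') × (z ≈ z')

  det : Vec3 → Vec3 → Vec3 → Carrier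
  det (a , b , c') (d , e , f) (g , h , i) =
    (a * (e * i - f * h) - b * (d * i - f * g)) + c' * (d * h - e * g)

  Collinear : Point → Point → Point → Set ℓ
  Collinear P Q R = det (coords P) (coords Q) (coords R) ≈ 0#

  lin : Carrier → Point → Carrier → Point → Vec3
  lin c₁ P c₂ Q with coords P | coords Q
  ... | (x , y , z) | (x' , y' , z') =
    ((c₁ * x + c₂ * x') , (c₁ * y + c₂ * y') , (c₁ * z + c₂ * z'))

  _≈V_ : Vec3 → Vec3 → Set ℓ
  (x , y , z) ≈V (x' , y' , z') = (x ≈ x') × (y ≈ y') × (z ≈ z')

  -- a finite point set K, given as a list; membership up to ≈P
  _∈K_ : Point → List Point → Set (c ⊔ ℓ)
  P ∈K K = Any (P ≈P_) K

  IsArc : List Point → Set (c ⊔ ℓ)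
  IsArc K = ∀ P₁ P₂ P₃ → P₁ ∈K K → P₂ ∈K K → P₃ ∈K K →
    ¬ (P₁ ≈P P₂) → ¬ (P₁ ≈P P₃) → ¬ (P₂ ≈P P₃) → ¬ Collinear P₁ P₂ P₃

  -- complete arc: an arc not contained in a larger arc, i.e. every arc
  -- containing K is contained in K
  IsCompleteArc : List Point → Set (c ⊔ ℓ)
  IsCompleteArc K = IsArc K ×
    (∀ K' → IsArc K' → (∀ P → P ∈K K → P ∈K K') → ∀ P → P ∈K K' → P ∈K K)

  IsSumPoint : List Point → Point → Set (c ⊔ ℓ)
  IsSumPoint K Q = ¬ (Q ∈K K) ×
    (∀ P₁ P₂ → P₁ ∈K K → P₂ ∈K K → ¬ (P₁ ≈P P₂) → Collinear Q P₁ P₂ →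
      ∀ c₁ c₂ → ¬ (c₁ ≈ 0#) → ¬ (c₂ ≈ 0#) →
      coords Q ≈V lin c₁ P₁ c₂ P₂ → c₁ ≈ c₂)

module Submission where

open import Defs
open import Level using (Level)
open import Data.Nat using (ℕ; suc; _^_)
open import Data.List using (List)
open import Data.Product using (∃)
open import Data.Nat using (_≤_; s≤s) renaming (_+_ to _+ℕ_)
import Data.Nat.Properties as ℕ
open import Data.Nat.Divisibility using (_∣_; _∣0; ∣-refl; m∣m*n; ∣1⇒≡1; ∣m∣n⇒∣m+n; ∣m+n∣m⇒∣n)
import Data.Fin as Fin
open import Data.List using ([]; _∷_; length)
open import Data.List.Properties using (length-removeAt′)
open import Data.List.Relation.Unary.Any as Any using (Any; here; there; _─_; index; any?)
open import Data.List.Relation.Unary.All.Properties using (─⁺)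
open import Data.List.Relation.Unary.AllPairs using (_∷_)
open import Data.Product using (_×_; _,_; proj₁; proj₂)
open import Data.Sum using (inj₁; inj₂)
open import Data.Empty using (⊥; ⊥-elim)
open import Function using (_∘_)
open import Relation.Nullary using (¬_; Dec; yes; no; _×-dec_)
open import Relation.Binary using (Setoid; Decidable; _Preserves_⟶_)
open import Relation.Binary.PropositionalEquality as ≡ using (_≡_)

-- Proof.  Write E = (0,0,1) and, for t ∈ F, A(t) = (0,1,t); these are the
-- normalized points of the line x = 0.
--
-- 1. A field whose order is even has characteristic 2: negation is an
--    involution of the nonzero elements, fixed-point-free unless 1 + 1 = 0,
--    and a duplicate-free list closed under a fixed-point-free involution has
--    even length (Pairing), while there are 2^(n+1) - 1 nonzero elements.
-- 2. In characteristic 2 an equation 0 = c₁u + c₂v with u = v = 1 forces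
--    c₁ = c₂.  Comparing coordinates of Q = c₁P₁ + c₂P₂ for normalized P₁ ≠ P₂
--    shows that E is a sum-point of any point set not containing it, and that
--    A(t) is one provided at most one of P₁, P₂ lies on A(·) and every
--    point A(s) of K satisfies t = s + 1.
-- 3. If E ∈ K, the arc property leaves at most one point A(s) in K (together
--    with E they would be three collinear points), so t = s + 1, or any t if
--    there is no such point, gives the sum-point A(t).

module Pairing {a ℓ} (S : Setoid a ℓ) where
  open Setoid S renaming (sym to ≈-sym)
  open import Data.List.Membership.Setoid S using (_∈_; _∉_)
  open import Data.List.Membership.Setoid.Properties using (∈-resp-≈; index-injective)
  open import Data.List.Relation.Unary.Unique.Setoid S using (Unique)
  open import Data.List.Relation.Unary.Unique.Setoid.Properties using (Unique[x∷xs]⇒x∉xs)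

  private variable
    x y h : Carrier
    xs : List Carrier

  head-not-in-tail : Unique (h ∷ xs) → x ≈ h → x ∉ xs
  head-not-in-tail u x≈h x∈xs = Unique[x∷xs]⇒x∉xs S u (∈-resp-≈ S x≈h x∈xs)

  ∈-─⁻ : (p : x ∈ xs) → y ∈ (xs ─ p) → y ∈ xs
  ∈-─⁻ (here _)  y∈       = there y∈
  ∈-─⁻ (there p) (here e) = here e
  ∈-─⁻ (there p) (there q) = there (∈-─⁻ p q)

  ∈-─⁺ : (p : x ∈ xs) → y ∈ xs → y ≉ x → y ∈ (xs ─ p)
  ∈-─⁺ (here x≈h) (here y≈h) y≉x = ⊥-elim (y≉x (trans y≈h (≈-sym x≈h)))
  ∈-─⁺ (here _)   (there q)  _   = q
  ∈-─⁺ (there p)  (here y≈h) _   = here y≈h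
  ∈-─⁺ (there p)  (there q)  y≉x = there (∈-─⁺ p q y≉x)

  ─-unique : (p : x ∈ xs) → Unique xs → Unique (xs ─ p)
  ─-unique (here _)  (_ ∷ u)   = u
  ─-unique (there p) (h≉ ∷ u)  = ─⁺ p h≉ ∷ ─-unique p u

  ∉-─ : Unique xs → (p : x ∈ xs) → y ∈ (xs ─ p) → y ≉ x
  ∉-─ u (here x≈h)        y∈ y≈x = head-not-in-tail u (trans y≈x x≈h) y∈
  ∉-─ u (there p) (here y≈h) y≈x = head-not-in-tail u (trans (≈-sym y≈x) y≈h) p
  ∉-─ (_ ∷ u) (there p) (there q) = ∉-─ u p q

  index-cong : Unique xs → (p : x ∈ xs) (q : y ∈ xs) → x ≈ y → index p ≡ index q
  index-cong _       (here _)   (here _)   _   = ≡.refl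
  index-cong u       (here x≈h) (there q)  x≈y = ⊥-elim (head-not-in-tail u (trans (≈-sym x≈y) x≈h) q)
  index-cong u       (there p)  (here y≈h) x≈y = ⊥-elim (head-not-in-tail u (trans x≈y y≈h) p)
  index-cong (_ ∷ u) (there p)  (there q)  x≈y = ≡.cong Fin.suc (index-cong u p q x≈y)

  enumerated⇒decidable : ∀ xs → Unique xs → (∀ x → x ∈ xs) → Decidable _≈_
  enumerated⇒decidable xs u cover x y with index (cover x) Fin.≟ index (cover y)
  ... | yes same = yes (index-injective S (cover x) (cover y) same)
  ... | no  diff = no (diff ∘ index-cong u (cover x) (cover y))

  module _ (σ : Carrier → Carrier) (σ-cong : σ Preserves _≈_ ⟶ _≈_)
           (σ-involutive : ∀ x → σ (σ x) ≈ x) where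

    σ-injective : σ y ≈ σ x → y ≈ x
    σ-injective {y} {x} σy≈σx =
      trans (≈-sym (σ-involutive y)) (trans (σ-cong σy≈σx) (σ-involutive x))

    -- A duplicate-free list closed under a fixed-point-free involution σ has
    -- even length: remove a pair x, σ x and recurse (on a bound k for the length).
    even-length : ∀ xs → Unique xs → (∀ {x} → x ∈ xs → σ x ∈ xs) →
                  (∀ {x} → x ∈ xs → x ≉ σ x) → 2 ∣ length xs
    even-length xs = bounded (length xs) xs ℕ.≤-refl
      where
      bounded : ∀ k xs → length xs ≤ k → Unique xs → (∀ {x} → x ∈ xs → σ x ∈ xs) →
                (∀ {x} → x ∈ xs → x ≉ σ x) → 2 ∣ length xs
      bounded k [] _ _ _ _ = 2 ∣0
      bounded (suc k) (x ∷ rest) (s≤s rest≤k) u@(_ ∷ rest-unique) closed free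
        with closed (here refl)
      ... | here σx≈x     = ⊥-elim (free (here refl) (≈-sym σx≈x))
      ... | there σx∈rest =
        ≡.subst (λ m → 2 ∣ suc m) (≡.sym length-rest)
          (∣m∣n⇒∣m+n ∣-refl
            (bounded k rest′ rest′≤k (─-unique σx∈rest rest-unique) closed′ free′))
        where
        rest′ : List Carrier
        rest′ = rest ─ σx∈rest
        length-rest : length rest ≡ suc (length rest′)
        length-rest = length-removeAt′ rest (index σx∈rest)
        rest′≤k : length rest′ ≤ k
        rest′≤k = ℕ.≤-trans (ℕ.n≤1+n _) (≡.subst (_≤ k) length-rest rest≤k)
        closed′ : ∀ {z} → z ∈ rest′ → σ z ∈ rest′
        closed′ z∈ with closed (there (∈-─⁻ σx∈rest z∈))
        ... | here σz≈x     = ⊥-elim (∉-─ rest-unique σx∈rest z∈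
                                 (trans (≈-sym (σ-involutive _)) (σ-cong σz≈x)))
        ... | there σz∈rest = ∈-─⁺ σx∈rest σz∈rest λ σz≈σx →
                                 head-not-in-tail u (σ-injective σz≈σx) (∈-─⁻ σx∈rest z∈)
        free′ : ∀ {z} → z ∈ rest′ → z ≉ σ z
        free′ z∈ = free (there (∈-─⁻ σx∈rest z∈))

module FieldFacts {c ℓ} (F : Field c ℓ) where
  open Field F
  open import Algebra.Properties.Ring ring using (-0#≈0#; -‿involutive; -‿injective; +-inverseˡ-unique)
  open import Relation.Binary.Reasoning.Setoid setoid
  open Pairing setoid

  zero-product : ∀ {x y} → ¬ (y ≈ 0#) → x * y ≈ 0# → x ≈ 0#
  zero-product {x} {y} y≉0 xy≈0 = begin
    x               ≈⟨ *-identityʳ x ⟨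
    x * 1#          ≈⟨ *-congˡ y*y⁻¹≈1 ⟨
    x * (y * y⁻¹)   ≈⟨ *-assoc x y y⁻¹ ⟨
    (x * y) * y⁻¹   ≈⟨ *-congʳ xy≈0 ⟩
    0# * y⁻¹        ≈⟨ zeroˡ y⁻¹ ⟩
    0#              ∎
    where
    y⁻¹ : Carrier
    y⁻¹ = proj₁ (inverse y y≉0)
    y*y⁻¹≈1 : y * y⁻¹ ≈ 1#
    y*y⁻¹≈1 = proj₂ (inverse y y≉0)

  double : ∀ x → x + x ≈ x * (1# + 1#)
  double x = begin
    x + x              ≈⟨ +-cong (*-identityʳ x) (*-identityʳ x) ⟨
    x * 1# + x * 1#    ≈⟨ distribˡ x 1# 1# ⟨
    x * (1# + 1#)      ∎

  negation-fixed⇒zero : ¬ (1# + 1# ≈ 0#) → ∀ {x} → x ≈ - x → x ≈ 0#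
  negation-fixed⇒zero 2≉0 {x} x≈-x = zero-product 2≉0 (begin
    x * (1# + 1#)   ≈⟨ double x ⟨
    x + x           ≈⟨ +-congˡ x≈-x ⟩
    x + - x         ≈⟨ -‿inverseʳ x ⟩
    0#              ∎)

  decidable-equality : ∀ {q} → HasOrder F q → Decidable _≈_
  decidable-equality (xs , unique , cover , _) = enumerated⇒decidable xs unique cover

  -- A field of even order has characteristic 2: otherwise negation pairs off
  -- the nonzero elements, whose number is odd.
  characteristic-two : ∀ {q} → HasOrder F q → 2 ∣ q → 1# + 1# ≈ 0#
  characteristic-two order@(xs , unique , cover , ≡.refl) 2∣q
    with decidable-equality order (1# + 1#) 0#
  ... | yes 2≈0 = 2≈0
  ... | no  2≉0 = ⊥-elim (2∤1 (∣m+n∣m⇒∣n 2∣nonzero+1 2∣nonzero))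
    where
    0∈xs : Any (0# ≈_) xs
    0∈xs = cover 0#
    nonzero : List Carrier
    nonzero = xs ─ 0∈xs
    -x≈0⇒x≈0 : ∀ {x} → - x ≈ 0# → x ≈ 0#
    -x≈0⇒x≈0 -x≈0 = -‿injective (trans -x≈0 (sym -0#≈0#))
    2∣nonzero : 2 ∣ length nonzero
    2∣nonzero = even-length -_ -‿cong -‿involutive nonzero (─-unique 0∈xs unique)
      (λ x∈ → ∈-─⁺ 0∈xs (cover _) (∉-─ unique 0∈xs x∈ ∘ -x≈0⇒x≈0))
      (λ x∈ → ∉-─ unique 0∈xs x∈ ∘ negation-fixed⇒zero 2≉0)
    2∣nonzero+1 : 2 ∣ length nonzero +ℕ 1
    2∣nonzero+1 = ≡.subst (2 ∣_) (≡.trans (length-removeAt′ xs (index 0∈xs)) (ℕ.+-comm 1 _)) 2∣q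
    2∤1 : ¬ (2 ∣ 1)
    2∤1 2∣1 with ∣1⇒≡1 2∣1
    ... | ()

  -- In characteristic 2 every element is its own negative, so a + b = 0
  -- means a = b.
  module CharacteristicTwo (2≈0 : 1# + 1# ≈ 0#) where

    x+x≈0 : ∀ x → x + x ≈ 0#
    x+x≈0 x = trans (double x) (trans (*-congˡ 2≈0) (zeroʳ x))

    sum-zero⇒equal : ∀ {a b} → a + b ≈ 0# → a ≈ b
    sum-zero⇒equal {a} {b} a+b≈0 = begin
      a     ≈⟨ +-inverseˡ-unique a b a+b≈0 ⟩
      - b   ≈⟨ +-inverseˡ-unique b b (x+x≈0 b) ⟨
      b     ∎

module Geometry {c ℓ} (F : Field c ℓ) where
  open Field F
  open Plane F
  open FieldFacts F using (module CharacteristicTwo)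
  open import Algebra.Properties.Ring ring using (-0#≈0#; +-cancelˡ)

  xOf yOf zOf : Point → Carrier
  xOf P = proj₁ (coords P)
  yOf P = proj₁ (proj₂ (coords P))
  zOf P = proj₂ (proj₂ (coords P))

  pattern affine x≈1          = inj₁ x≈1
  pattern axial x≈0 y≈1       = inj₂ (inj₁ (x≈0 , y≈1))
  pattern pole x≈0 y≈0 z≈1    = inj₂ (inj₂ (x≈0 , y≈0 , z≈1))

  Axial IsPole : Point → Set ℓ
  Axial P  = (xOf P ≈ 0#) × (yOf P ≈ 1#)
  IsPole P = (xOf P ≈ 0#) × (yOf P ≈ 0#) × (zOf P ≈ 1#)

  axial-point : Carrier → Point
  axial-point t = (0# , 1# , t) , axial refl refl

  pole-point : Point
  pole-point = (0# , 0# , 1#) , pole refl refl refl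

  -- Points up to _≈P_ form a setoid whose membership relation is _∈K_; this
  -- gives access to the library's witness extraction  find.
  pointSetoid : Setoid (c Level.⊔ ℓ) ℓ
  pointSetoid = record
    { Carrier       = Point
    ; _≈_           = _≈P_
    ; isEquivalence = record
      { refl  = refl , refl , refl
      ; sym   = λ (ex , ey , ez) → sym ex , sym ey , sym ez
      ; trans = λ (ex , ey , ez) (ex′ , ey′ , ez′) → trans ex ex′ , trans ey ey′ , trans ez ez′
      }
    }

  open import Data.List.Membership.Setoid pointSetoid using (find)

  *-one : ∀ {u} c → u ≈ 1# → c * u ≈ c
  *-one c u≈1 = trans (*-congˡ u≈1) (*-identityʳ c)

  *-zero : ∀ {u} c → u ≈ 0# → c * u ≈ 0#
  *-zero c u≈0 = trans (*-congˡ u≈0) (zeroʳ c)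

  zero-* : ∀ {u} c → u ≈ 0# → u * c ≈ 0#
  zero-* c u≈0 = trans (*-congʳ u≈0) (zeroˡ c)

  picks-first : ∀ {u v w c₁ c₂} → u ≈ 1# → v ≈ 0# → w ≈ c₁ * u + c₂ * v → w ≈ c₁
  picks-first {c₁ = c₁} {c₂} u≈1 v≈0 e =
    trans e (trans (+-cong (*-one c₁ u≈1) (*-zero c₂ v≈0)) (+-identityʳ c₁))

  swap-sum : ∀ {w a b} → w ≈ a + b → w ≈ b + a
  swap-sum {a = a} {b} e = trans e (+-comm a b)

  picks-second : ∀ {u v w c₁ c₂} → u ≈ 0# → v ≈ 1# → w ≈ c₁ * u + c₂ * v → w ≈ c₂
  picks-second u≈0 v≈1 e = picks-first v≈1 u≈0 (swap-sum e)

  first-vanishes : ∀ {u v c₁ c₂} → u ≈ 1# → v ≈ 0# → 0# ≈ c₁ * u + c₂ * v → c₁ ≈ 0#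
  first-vanishes u≈1 v≈0 e = sym (picks-first u≈1 v≈0 e)

  second-vanishes : ∀ {u v c₁ c₂} → u ≈ 0# → v ≈ 1# → 0# ≈ c₁ * u + c₂ * v → c₂ ≈ 0#
  second-vanishes u≈0 v≈1 e = sym (picks-second u≈0 v≈1 e)

  offset-coefficient : ∀ {v z t c₁ c₂} → 1# ≈ c₁ → v ≈ 1# →
                       t ≈ c₁ * z + c₂ * v → t ≈ z + 1# → c₂ ≈ 1#
  offset-coefficient {z = z} {c₁ = c₁} {c₂} 1≈c₁ v≈1 e t≈z+1 =
    +-cancelˡ z c₂ 1# (trans (sym (trans e (+-cong c₁z≈z (*-one c₂ v≈1)))) t≈z+1)
    where
    c₁z≈z : c₁ * z ≈ z
    c₁z≈z = trans (*-congʳ (sym 1≈c₁)) (*-identityˡ z)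

  -- Three points on the line x = 0 are collinear: the first column of the
  -- determinant vanishes.
  x=0-collinear : ∀ P Q R → xOf P ≈ 0# → xOf Q ≈ 0# → xOf R ≈ 0# → Collinear P Q R
  x=0-collinear ((a , b , c′) , _) ((d , e , f) , _) ((g , h , i) , _) a≈0 d≈0 g≈0 =
    sum-of-zeros
      (difference-of-zeros (zero-* _ a≈0) (*-zero b (difference-of-zeros (zero-* i d≈0) (*-zero f g≈0))))
      (*-zero c′ (difference-of-zeros (zero-* h d≈0) (*-zero e g≈0)))
    where
    sum-of-zeros : ∀ {u v} → u ≈ 0# → v ≈ 0# → u + v ≈ 0#
    sum-of-zeros u≈0 v≈0 = trans (+-cong u≈0 v≈0) (+-identityʳ 0#)
    difference-of-zeros : ∀ {u v} → u ≈ 0# → v ≈ 0# → u - v ≈ 0#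
    difference-of-zeros u≈0 v≈0 = sum-of-zeros u≈0 (trans (-‿cong v≈0) -0#≈0#)

  pole-unique : ∀ P R → IsPole P → IsPole R → P ≈P R
  pole-unique P R (x₁≈0 , y₁≈0 , z₁≈1) (x₂≈0 , y₂≈0 , z₂≈1) =
    trans x₁≈0 (sym x₂≈0) , trans y₁≈0 (sym y₂≈0) , trans z₁≈1 (sym z₂≈1)

  axial≉pole : ∀ P R → yOf P ≈ 1# → yOf R ≈ 0# → ¬ (P ≈P R)
  axial≉pole P R y₁≈1 y₂≈0 (_ , y₁≈y₂ , _) = 0≉1 (trans (sym y₂≈0) (trans (sym y₁≈y₂) y₁≈1))

  module SumPoints (2≈0 : 1# + 1# ≈ 0#) where
    open CharacteristicTwo 2≈0 using (sum-zero⇒equal)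

    equal-coefficients : ∀ {u v c₁ c₂} → u ≈ 1# → v ≈ 1# → 0# ≈ c₁ * u + c₂ * v → c₁ ≈ c₂
    equal-coefficients {c₁ = c₁} {c₂} u≈1 v≈1 e =
      sum-zero⇒equal (sym (trans e (+-cong (*-one c₁ u≈1) (*-one c₂ v≈1))))

    -- E = (0,0,1) satisfies the secant condition for any pair of distinct
    -- normalized points: compare x-, then y-coordinates.
    pole-balanced : ∀ P₁ P₂ → ¬ (P₁ ≈P P₂) → ∀ c₁ c₂ → ¬ (c₁ ≈ 0#) → ¬ (c₂ ≈ 0#) →
                    coords pole-point ≈V lin c₁ P₁ c₂ P₂ → c₁ ≈ c₂
    pole-balanced P₁ P₂ P₁≉P₂ c₁ c₂ c₁≉0 c₂≉0 (ex , ey , _) with proj₂ P₁ | proj₂ P₂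
    ... | affine a     | affine b     = equal-coefficients a b ex
    ... | affine a     | axial b _    = ⊥-elim (c₁≉0 (first-vanishes a b ex))
    ... | affine a     | pole b _ _   = ⊥-elim (c₁≉0 (first-vanishes a b ex))
    ... | axial a _    | affine b     = ⊥-elim (c₂≉0 (second-vanishes a b ex))
    ... | pole a _ _   | affine b     = ⊥-elim (c₂≉0 (second-vanishes a b ex))
    ... | axial _ a    | axial _ b    = equal-coefficients a b ey
    ... | axial _ a    | pole _ b _   = ⊥-elim (c₁≉0 (first-vanishes a b ey))
    ... | pole _ a _   | axial _ b    = ⊥-elim (c₂≉0 (second-vanishes a b ey))
    ... | pole a b c′  | pole a′ b′ c″ = ⊥-elim (P₁≉P₂ (pole-unique P₁ P₂ (a , b , c′) (a′ , b′ , c″)))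

    -- A(t) = (0,1,t) satisfies the secant condition for distinct normalized
    -- P₁, P₂ that are not both of the form A(s), provided t = s + 1 for
    -- each of them that is: if P₁ = A(s) and P₂ = E, the y-coordinate gives
    -- c₁ = 1 and the z-coordinate t = s + c₂ gives c₂ = 1.
    axial-balanced : ∀ t P₁ P₂ → ¬ (Axial P₁ × Axial P₂) →
                     (Axial P₁ → t ≈ zOf P₁ + 1#) → (Axial P₂ → t ≈ zOf P₂ + 1#) →
                     ¬ (P₁ ≈P P₂) → ∀ c₁ c₂ → ¬ (c₁ ≈ 0#) → ¬ (c₂ ≈ 0#) →
                     coords (axial-point t) ≈V lin c₁ P₁ c₂ P₂ → c₁ ≈ c₂
    axial-balanced t P₁ P₂ not-both offset₁ offset₂ P₁≉P₂ c₁ c₂ c₁≉0 c₂≉0 (ex , ey , ez)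
      with proj₂ P₁ | proj₂ P₂
    ... | affine a     | affine b     = equal-coefficients a b ex
    ... | affine a     | axial b _    = ⊥-elim (c₁≉0 (first-vanishes a b ex))
    ... | affine a     | pole b _ _   = ⊥-elim (c₁≉0 (first-vanishes a b ex))
    ... | axial a _    | affine b     = ⊥-elim (c₂≉0 (second-vanishes a b ex))
    ... | pole a _ _   | affine b     = ⊥-elim (c₂≉0 (second-vanishes a b ex))
    ... | axial a₀ a₁  | axial b₀ b₁  = ⊥-elim (not-both ((a₀ , a₁) , (b₀ , b₁)))
    ... | axial a₀ a₁  | pole _ b₁ b₂ = trans (sym 1≈c₁) (sym c₂≈1)
      where
      1≈c₁ : 1# ≈ c₁
      1≈c₁ = picks-first a₁ b₁ ey
      c₂≈1 : c₂ ≈ 1#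
      c₂≈1 = offset-coefficient 1≈c₁ b₂ ez (offset₁ (a₀ , a₁))
    ... | pole _ a₁ a₂ | axial b₀ b₁  = trans c₁≈1 1≈c₂
      where
      1≈c₂ : 1# ≈ c₂
      1≈c₂ = picks-second a₁ b₁ ey
      c₁≈1 : c₁ ≈ 1#
      c₁≈1 = offset-coefficient 1≈c₂ a₂ (swap-sum ez) (offset₂ (b₀ , b₁))
    ... | pole a b c′  | pole a′ b′ c″ = ⊥-elim (P₁≉P₂ (pole-unique P₁ P₂ (a , b , c′) (a′ , b′ , c″)))

    module _ (_≟_ : Decidable _≈_) (K : List Point) (arc : IsArc K) where

      axial? : ∀ P → Dec (Axial P)
      axial? P = (xOf P ≟ 0#) ×-dec (yOf P ≟ 1#)

      pole? : ∀ P → Dec (IsPole P)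
      pole? P = (xOf P ≟ 0#) ×-dec (yOf P ≟ 0#) ×-dec (zOf P ≟ 1#)

      NoTwoAxial : Set (c Level.⊔ ℓ)
      NoTwoAxial = ∀ P R → P ∈K K → R ∈K K → Axial P → Axial R → ¬ (P ≈P R) → ⊥

      -- If E ∈ K, two distinct points A(s), A(s′) of K would be collinear with E.
      pole⇒no-two-axial : ∀ {E} → E ∈K K → IsPole E → NoTwoAxial
      pole⇒no-two-axial {E} E∈K (e₀ , e₁ , _) P R P∈K R∈K (p₀ , p₁) (r₀ , r₁) P≉R =
        arc P R E P∈K R∈K E∈K P≉R (axial≉pole P E p₁ e₁) (axial≉pole R E r₁ e₁)
          (x=0-collinear P R E p₀ r₀ e₀)

      -- A(t) is a sum-point of K once t = s + 1 for every point A(s) of K;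
      -- in particular A(t) ∉ K, as t ≠ t + 1.
      axial-sum-point : NoTwoAxial → ∀ t → (∀ P → P ∈K K → Axial P → t ≈ zOf P + 1#) →
                        IsSumPoint K (axial-point t)
      axial-sum-point no-two t offset = A[t]∉K , λ P₁ P₂ P₁∈K P₂∈K P₁≉P₂ _ →
        axial-balanced t P₁ P₂ (λ (ax₁ , ax₂) → no-two P₁ P₂ P₁∈K P₂∈K ax₁ ax₂ P₁≉P₂)
          (offset P₁ P₁∈K) (offset P₂ P₂∈K) P₁≉P₂
        where
        A[t]∉K : ¬ (axial-point t ∈K K)
        A[t]∉K A[t]∈K with find A[t]∈K
        ... | R , R∈K , (x≈ , y≈ , t≈z) = 0≉1 (+-cancelˡ t 0# 1# (begin
          t + 0#        ≈⟨ +-identityʳ t ⟩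
          t             ≈⟨ offset R R∈K (sym x≈ , sym y≈) ⟩
          zOf R + 1#    ≈⟨ +-congʳ t≈z ⟨
          t + 1#        ∎))
          where open import Relation.Binary.Reasoning.Setoid setoid

      -- When K has at most one point A(s), a suitable t exists: s + 1, or
      -- anything if there is no such point.
      offset-exists : NoTwoAxial → ∃ λ t → ∀ P → P ∈K K → Axial P → t ≈ zOf P + 1#
      offset-exists no-two with any? axial? K
      ... | no none = 0# , λ P P∈K (x≈0 , y≈1) → ⊥-elim (none (Any.map
                        (λ (ex , ey , _) → trans (sym ex) x≈0 , trans (sym ey) y≈1) P∈K))
      ... | yes some with find some
      ... | S , S∈K , axS = zOf S + 1# , λ P P∈K axP → +-congʳ (same-z P P∈K axP)
        where
        same-z : ∀ P → P ∈K K → Axial P → zOf S ≈ zOf P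
        same-z P P∈K axP with zOf S ≟ zOf P
        ... | yes z≈ = z≈
        ... | no  z≉ = ⊥-elim (no-two S P S∈K P∈K axS axP (z≉ ∘ proj₂ ∘ proj₂))

      sum-point-exists : ∃ λ Q → IsSumPoint K Q
      sum-point-exists with any? pole? K
      ... | no no-pole = pole-point , E∉K , λ P₁ P₂ _ _ P₁≉P₂ _ → pole-balanced P₁ P₂ P₁≉P₂
        where
        E∉K : ¬ (pole-point ∈K K)
        E∉K = no-pole ∘ Any.map (λ (ex , ey , ez) → sym ex , sym ey , sym ez)
      ... | yes some with find some
      ... | E , E∈K , isPole = axial-point t , axial-sum-point no-two t offset
        where
        no-two : NoTwoAxial
        no-two = pole⇒no-two-axial {E} E∈K isPole
        t : Carrier
        t = proj₁ (offset-exists no-two)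
        offset : ∀ P → P ∈K K → Axial P → t ≈ zOf P + 1#
        offset = proj₂ (offset-exists no-two)

lemma2p3 : ∀ {c ℓ : Level} (F : Field c ℓ) (n : ℕ) → HasOrder F (2 ^ suc n) →
    let open Plane F in
    (K : List Point) → IsCompleteArc K → ∃ λ Q → IsSumPoint K Q
lemma2p3 F n order K (arc , _) = sum-point-exists (decidable-equality order) K arc
  where
  open FieldFacts F using (decidable-equality; characteristic-two)
  open Geometry.SumPoints F (characteristic-two order (m∣m*n (2 ^ n)))
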